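{- Let $n\geq 1$, $r\geq 2$, $t\geq 1$ be integers and let $\mathcal{F}\subset 2^{[n]}$ be a nonempty $r$-wise $t$-intersecting family which is not a $t$-star, i.e. $\left|\bigcap_{F\in\mathcal{F}}F\right|<t$. Then for every integer $s$ with $2\leq s<r$, $\mathcal{F}$ is $s$-wise $(t+r-s)$-intersecting.
   Context: $2^{[n]}$ is the power set of $[n]=\{1,\dots,n\}$. A family $\mathcal{F}$ is $r$-wise $t$-intersecting if $|F_1\cap\dots\cap F_r|\geq t$ for all (not necessarily distinct) $F_1,\dots,F_r\in\mathcal{F}$. -}

module Defs where

open import Data.Nat using (ℕ; _≤_; _<_)
open import Data.Fin.Subset using (Subset; _∩_; ⊤; ∣_∣)
open import Data.List using (List; [])
import Data.List as List
open import Data.Vec using (Vec)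
import Data.Vec as Vec
open import Data.List.Membership.Propositional using (_∈_)
open import Data.Vec.Relation.Unary.All using (All)
open import Data.Product using (Σ)

-- A family 𝓕 ⊆ 2^[n] is represented as a finite list of subsets of Fin n
-- (a list, since 2^[n] is finite; repetitions are irrelevant).
Family : ℕ → Set
Family n = List (Subset n)

-- Intersection of a vector of sets (F₁ ∩ … ∩ F_r); empty intersection = [n].
⋂ᵥ : ∀ {n r} → Vec (Subset n) r → Subset n
⋂ᵥ = Vec.foldr _ _∩_ ⊤

⋂ : ∀ {n} → Family n → Subset n
⋂ = List.foldr _∩_ ⊤

-- r-wise t-intersecting: |F₁ ∩ … ∩ F_r| ≥ t for all (not necessarily distinct) Fᵢ ∈ 𝓕.
RWiseTIntersecting : ∀ {n} → ℕ → ℕ → Family n → Set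
RWiseTIntersecting {n} r t 𝓕 =
  (Fs : Vec (Subset n) r) → All (_∈ 𝓕) Fs → t ≤ ∣ ⋂ᵥ Fs ∣

NonEmpty : ∀ {n} → Family n → Set
NonEmpty {n} 𝓕 = Σ (Subset n) (λ F → F ∈ 𝓕)

NotTStar : ∀ {n} → ℕ → Family n → Set
NotTStar t 𝓕 = ∣ ⋂ 𝓕 ∣ < t

{-# OPTIONS --safe #-}
module Submission where

open import Defs
open import Data.Nat using (ℕ; _≤_; _<_; _+_; _∸_; suc; s≤s)
open import Data.Nat.Properties
  using (≤-trans; ≤⇒≯; <⇒≤; ≰⇒>; <⇒≱; m≤n+m; +-suc; +-comm; m∸n+n≡m; module ≤-Reasoning)
open import Data.Bool using (true; false)
open import Data.Vec using (_∷_)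
open import Data.List.Membership.Propositional using (_∈_)
open import Data.List.Relation.Unary.All as ListAll using ()
open import Data.Vec.Relation.Unary.All using (_∷_)
open import Data.Fin.Subset using (Subset; _∩_; ∣_∣; _⊆_)
open import Data.Fin.Subset.Properties using (s⊆s; out⊆; ⊆⊤; x∈p∩q⁺; ∣p∩q∣≤∣q∣; p⊆q⇒∣p∣≤∣q∣)
open import Data.Product using (_,_)
open import Data.Empty using (⊥-elim)
open import Relation.Nullary using (¬_)
open import Relation.Binary.PropositionalEquality using (subst; sym)

-- If 𝓕 is (m+2)-wise t-intersecting and I = F₁ ∩ … ∩ F_{m+1} has |I| ≤ t,
-- then |G ∩ I| ≥ t ≥ |I| forces I ⊆ G for every G ∈ 𝓕, so |⋂ 𝓕| ≥ |I| ≥ t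
-- and 𝓕 is a t-star. So for a family that is not a t-star, dropping one set
-- from the intersections raises the threshold by one; repeat r − s times.

∣q∣≤∣p∩q∣⇒q⊆p : ∀ {n} (p q : Subset n) → ∣ q ∣ ≤ ∣ p ∩ q ∣ → q ⊆ p
∣q∣≤∣p∩q∣⇒q⊆p (true  ∷ p) (true  ∷ q) (s≤s h) = s⊆s (∣q∣≤∣p∩q∣⇒q⊆p p q h)
∣q∣≤∣p∩q∣⇒q⊆p (false ∷ p) (true  ∷ q) h       = ⊥-elim (≤⇒≯ (∣p∩q∣≤∣q∣ p q) h)
∣q∣≤∣p∩q∣⇒q⊆p (true  ∷ p) (false ∷ q) h       = out⊆ (∣q∣≤∣p∩q∣⇒q⊆p p q h)
∣q∣≤∣p∩q∣⇒q⊆p (false ∷ p) (false ∷ q) h       = out⊆ (∣q∣≤∣p∩q∣⇒q⊆p p q h)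

⊆-⋂ : ∀ {n} {p : Subset n} {𝓕 : Family n} → ListAll.All (p ⊆_) 𝓕 → p ⊆ ⋂ 𝓕
⊆-⋂ ListAll.[]          = ⊆⊤
⊆-⋂ (p⊆G ListAll.∷ p⊆𝓕) x∈p = x∈p∩q⁺ (p⊆G x∈p , ⊆-⋂ p⊆𝓕 x∈p)

module _ {n} {𝓕 : Family n} where

  lower-arity : ∀ {m t} → RWiseTIntersecting (suc (suc m)) t 𝓕 → NotTStar t 𝓕 →
                RWiseTIntersecting (suc m) (suc t) 𝓕
  lower-arity {t = t} R notStar (F ∷ Fs) Fs∈𝓕@(F∈𝓕 ∷ _) = ≰⇒> ∣I∣≰t
    where
    I : Subset n
    I = ⋂ᵥ (F ∷ Fs)

    t≤∣G∩I∣ : ∀ {G} → G ∈ 𝓕 → t ≤ ∣ G ∩ I ∣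
    t≤∣G∩I∣ G∈𝓕 = R (_ ∷ F ∷ Fs) (G∈𝓕 ∷ Fs∈𝓕)

    ∣I∣≰t : ¬ ∣ I ∣ ≤ t
    ∣I∣≰t ∣I∣≤t = <⇒≱ notStar (begin
      t       ≤⟨ ≤-trans (t≤∣G∩I∣ F∈𝓕) (∣p∩q∣≤∣q∣ F I) ⟩
      ∣ I ∣   ≤⟨ p⊆q⇒∣p∣≤∣q∣ (⊆-⋂ (ListAll.tabulate I⊆G)) ⟩
      ∣ ⋂ 𝓕 ∣ ∎)
      where
      open ≤-Reasoning
      I⊆G : ∀ {G} → G ∈ 𝓕 → I ⊆ G
      I⊆G G∈𝓕 = ∣q∣≤∣p∩q∣⇒q⊆p _ I (≤-trans ∣I∣≤t (t≤∣G∩I∣ G∈𝓕))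

  lower-arity-by : ∀ d {s t} → RWiseTIntersecting (d + suc s) t 𝓕 → NotTStar t 𝓕 →
                   RWiseTIntersecting (suc s) (d + t) 𝓕
  lower-arity-by 0       R _       = R
  lower-arity-by (suc d) {s} {t} R notStar =
    lower-arity (lower-arity-by d R′ notStar) (≤-trans notStar (m≤n+m t d))
    where
    R′ : RWiseTIntersecting (d + suc (suc s)) t 𝓕
    R′ = subst (λ k → RWiseTIntersecting k t 𝓕) (sym (+-suc d (suc s))) R

fact2p5 : (n r t : ℕ) → 1 ≤ n → 2 ≤ r → 1 ≤ t →
    (𝓕 : Family n) → NonEmpty 𝓕 → RWiseTIntersecting r t 𝓕 → NotTStar t 𝓕 →
    (s : ℕ) → 2 ≤ s → s < r → RWiseTIntersecting s (t + (r ∸ s)) 𝓕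
fact2p5 n r t _ _ _ 𝓕 _ R notStar (suc s) _ s<r =
  subst (λ u → RWiseTIntersecting (suc s) u 𝓕) (+-comm (r ∸ suc s) t)
    (lower-arity-by (r ∸ suc s) R′ notStar)
  where
  R′ : RWiseTIntersecting (r ∸ suc s + suc s) t 𝓕
  R′ = subst (λ k → RWiseTIntersecting k t 𝓕) (sym (m∸n+n≡m (<⇒≤ s<r))) R
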